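{- Let $A\subseteq\{0,1\}^n$ be a covering array of strength $k$ that is not a covering array of strength $k+1$. Then $|A|\leq 2^{n-1}(2-2^{ -k})$.
   Context: For $I=\{i_1,\dots,i_t\}\subseteq[n]$ and $x\in\{0,1\}^n$ write $x_I=(x_{i_1},\dots,x_{i_t})$. A set $A\subseteq\{0,1\}^n$ is a covering array of strength $t$ if for every $t$-subset $I\subseteq[n]$ and every $a\in\{0,1\}^t$ there exists $x\in A$ with $x_I=a$. -}

module Defs where

open import Data.Nat using (ℕ; _<_)
open import Data.Bool using (Bool)
open import Data.Fin using (Fin; toℕ; suc)
open import Data.Vec using (Vec; lookup; map)
open import Data.List using (List)
open import Data.List.Membership.Propositional using (_∈_)
open import Data.Product using (∃; _×_)
open import Relation.Binary.PropositionalEquality using (_≡_)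

-- A t-subset I = {i₁ < … < i_t} of [n], given as a strictly increasing
-- sequence of indices.
StrictlyIncreasing : ∀ {n t} → Vec (Fin n) t → Set
StrictlyIncreasing {t = t} I = (a b : Fin t) → toℕ a < toℕ b → toℕ (lookup I a) < toℕ (lookup I b)

restrict : ∀ {n t} → Vec Bool n → Vec (Fin n) t → Vec Bool t
restrict x I = map (lookup x) I

-- A ⊆ {0,1}ⁿ (a list; intended without duplicates) is a covering array of strength t
CoveringArray : ∀ {n} → ℕ → List (Vec Bool n) → Set
CoveringArray {n} t A =
  (I : Vec (Fin n) t) → StrictlyIncreasing I →
  (a : Vec Bool t) → ∃ λ x → x ∈ A × restrict x I ≡ a

{-# OPTIONS --safe #-}
-- If the word a does not occur on the (k+1)-set I, then A misses the whole subcube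
-- {x : x_I = a} of 2^(n-k-1) points, so |A| ≤ 2^n - 2^(n-k-1), which is the bound. The subcube is described by a partial
-- assignment, and the count is an induction on n splitting A by the first coordinate.
-- The uncovered pair need not be extracted from ¬ CoveringArray constructively:
-- the bound is decidable, so it suffices to refute its negation.
module Submission where

open import Defs
open import Data.Nat using (ℕ; _*_; _∸_; _^_; _≤_; suc)
open import Data.Bool using (Bool)
open import Data.Vec using (Vec)
open import Data.List using (List; length)
open import Data.List.Relation.Unary.Unique.Propositional using (Unique)
open import Relation.Nullary using (¬_)

open import Data.Bool using (true; false; not) renaming (_≟_ to _≟ᵇ_)
open import Data.Empty using (⊥-elim)
open import Data.Fin using (Fin)
import Data.Fin.Properties as Finₚ
open import Data.List using ([]; _∷_)
open import Data.List.Membership.Propositional using (find)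
open import Data.List.Relation.Unary.All as All using (All; []; _∷_)
open import Data.List.Relation.Unary.All.Properties using (¬Any⇒All¬)
open import Data.List.Relation.Unary.AllPairs using ([]; _∷_)
open import Data.List.Relation.Unary.Any using (any?)
open import Data.Maybe using (Maybe; just; nothing)
import Data.Maybe.Relation.Unary.All as Maybe
open import Data.Nat using (zero; _+_; z≤n; s≤s; z<s; s<s; _≤?_)
open import Data.Nat.Properties
open import Algebra.Properties.CommutativeSemigroup +-commutativeSemigroup using (interchange; xy∙z≈xz∙y)
open import Data.Vec using ([]; _∷_; lookup; replicate; _[_]≔_)
open import Data.Vec.Properties using (lookup∘update; lookup∘update′; ≡-dec)
open import Data.Vec.Relation.Binary.Pointwise.Inductive as Pointwise using (Pointwise)
open import Data.Vec.Relation.Unary.All.Properties using (lookup⁺; lookup⁻)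
open import Data.Vec.Relation.Unary.AllPairs using ([]; _∷_)
import Data.Vec.Relation.Unary.Unique.Propositional as Vec
open import Function using (_∘_)
open import Relation.Binary.PropositionalEquality
open import Relation.Nullary using (Dec; yes; no; contradiction)
open import Relation.Nullary.Decidable using (decidable-stable)

private
  variable
    n t : ℕ

-- The points matching p form a subcube of dimension free p.
Pattern : ℕ → Set
Pattern = Vec (Maybe Bool)

Matches : Pattern n → Vec Bool n → Set
Matches = Pointwise (λ entry b → Maybe.All (_≡ b) entry)

free : Pattern n → ℕ
free []            = 0
free (nothing ∷ p) = suc (free p)
free (just _ ∷ p)  = free p

slice : Bool → List (Vec Bool (suc n)) → List (Vec Bool n)
slice b []                          = []
slice true  ((true  ∷ x) ∷ A)       = x ∷ slice true A
slice false ((false ∷ x) ∷ A)       = x ∷ slice false A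
slice b     ((_     ∷ _) ∷ A)       = slice b A

slice-All : ∀ {P : Vec Bool (suc n) → Set} b {A} → All P A → All (P ∘ (b ∷_)) (slice b A)
slice-All b     {[]}              []         = []
slice-All true  {(true  ∷ _) ∷ _} (px ∷ pxs) = px ∷ slice-All true pxs
slice-All true  {(false ∷ _) ∷ _} (_  ∷ pxs) = slice-All true pxs
slice-All false {(true  ∷ _) ∷ _} (_  ∷ pxs) = slice-All false pxs
slice-All false {(false ∷ _) ∷ _} (px ∷ pxs) = px ∷ slice-All false pxs

slice-Unique : ∀ b {A : List (Vec Bool (suc n))} → Unique A → Unique (slice b A)
slice-Unique b     {[]}              []         = []
slice-Unique true  {(true  ∷ _) ∷ _} (x∉ ∷ u)   = All.map (_∘ cong (true ∷_)) (slice-All true x∉) ∷ slice-Unique true u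
slice-Unique true  {(false ∷ _) ∷ _} (_  ∷ u)   = slice-Unique true u
slice-Unique false {(true  ∷ _) ∷ _} (_  ∷ u)   = slice-Unique false u
slice-Unique false {(false ∷ _) ∷ _} (x∉ ∷ u)   = All.map (_∘ cong (false ∷_)) (slice-All false x∉) ∷ slice-Unique false u

length-slices : ∀ b (A : List (Vec Bool (suc n))) → length A ≡ length (slice b A) + length (slice (not b) A)
length-slices b     []                = refl
length-slices true  ((true  ∷ _) ∷ A) = cong suc (length-slices true A)
length-slices true  ((false ∷ _) ∷ A) = trans (cong suc (length-slices true A)) (sym (+-suc _ _))
length-slices false ((true  ∷ _) ∷ A) = trans (cong suc (length-slices false A)) (sym (+-suc _ _))
length-slices false ((false ∷ _) ∷ A) = cong suc (length-slices false A)

Unique⇒length≤2^n : (A : List (Vec Bool n)) → Unique A → length A ≤ 2 ^ n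
Unique⇒length≤2^n {zero}  []                  _                  = z≤n
Unique⇒length≤2^n {zero}  ([] ∷ [])           _                  = ≤-refl
Unique⇒length≤2^n {zero}  ([] ∷ [] ∷ _)       ((x≢x ∷ _) ∷ _)    = ⊥-elim (x≢x refl)
Unique⇒length≤2^n {suc n} A                   u                  = begin
  length A                                      ≡⟨ length-slices true A ⟩
  length (slice true A) + length (slice false A) ≤⟨ +-mono-≤ (Unique⇒length≤2^n _ (slice-Unique true u))
                                                     (Unique⇒length≤2^n _ (slice-Unique false u)) ⟩
  2 ^ n + 2 ^ n                                 ≡⟨ cong (2 ^ n +_) (sym (+-identityʳ _)) ⟩
  2 ^ suc n                                     ∎
  where open ≤-Reasoning

avoiding⇒length+2^free≤2^n : (p : Pattern n) (A : List (Vec Bool n)) → Unique A → All (¬_ ∘ Matches p) A →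
                              length A + 2 ^ free p ≤ 2 ^ n
avoiding⇒length+2^free≤2^n []            []       _ _            = ≤-refl
avoiding⇒length+2^free≤2^n []            ([] ∷ _) _ (¬match ∷ _) = ⊥-elim (¬match Pointwise.[])
avoiding⇒length+2^free≤2^n {suc n} (nothing ∷ p) A u avoids
  rewrite length-slices true A =
  both-slices _ _ (2 ^ free p) (2 ^ n)
    (avoiding⇒length+2^free≤2^n p _ (slice-Unique true u)  (All.map (_∘ (Maybe.nothing Pointwise.∷_)) (slice-All true avoids)))
    (avoiding⇒length+2^free≤2^n p _ (slice-Unique false u) (All.map (_∘ (Maybe.nothing Pointwise.∷_)) (slice-All false avoids)))
  where
  both-slices : ∀ a b c N → a + c ≤ N → b + c ≤ N → a + b + 2 * c ≤ 2 * N
  both-slices a b c N a+c≤N b+c≤N = begin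
    a + b + (c + (c + 0)) ≡⟨ cong (λ d → a + b + (c + d)) (+-identityʳ c) ⟩
    (a + b) + (c + c)     ≡⟨ interchange a b c c ⟩
    (a + c) + (b + c)     ≤⟨ +-mono-≤ a+c≤N b+c≤N ⟩
    N + N                 ≡⟨ cong (N +_) (sym (+-identityʳ N)) ⟩
    N + (N + 0)           ∎
    where open ≤-Reasoning
avoiding⇒length+2^free≤2^n {suc n} (just b ∷ p) A u avoids
  rewrite length-slices b A =
  one-slice _ _ (2 ^ free p) (2 ^ n)
    (avoiding⇒length+2^free≤2^n p _ (slice-Unique b u) (All.map (_∘ (Maybe.just refl Pointwise.∷_)) (slice-All b avoids)))
    (Unique⇒length≤2^n _ (slice-Unique (not b) u))
  where
  one-slice : ∀ a b c N → a + c ≤ N → b ≤ N → a + b + c ≤ 2 * N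
  one-slice a b c N a+c≤N b≤N = begin
    a + b + c             ≡⟨ xy∙z≈xz∙y a b c ⟩
    (a + c) + b           ≤⟨ +-mono-≤ a+c≤N b≤N ⟩
    N + N                 ≡⟨ cong (N +_) (sym (+-identityʳ N)) ⟩
    N + (N + 0)           ∎
    where open ≤-Reasoning

fixing : Vec (Fin n) t → Vec Bool t → Pattern n
fixing {n} []      []      = replicate n nothing
fixing     (i ∷ I) (b ∷ a) = fixing I a [ i ]≔ just b

free-replicate : ∀ n → free (replicate n nothing) ≡ n
free-replicate zero    = refl
free-replicate (suc n) = cong suc (free-replicate n)

free-update : (p : Pattern n) (i : Fin n) (b : Bool) → free p ≤ suc (free (p [ i ]≔ just b))
free-update (nothing ∷ p) Fin.zero    b = ≤-refl
free-update (just _  ∷ p) Fin.zero    b = n≤1+n _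
free-update (nothing ∷ p) (Fin.suc i) b = s≤s (free-update p i b)
free-update (just _  ∷ p) (Fin.suc i) b = free-update p i b

free-fixing : (I : Vec (Fin n) t) (a : Vec Bool t) → n ≤ t + free (fixing I a)
free-fixing {n} []      []      = ≤-reflexive (sym (free-replicate n))
free-fixing {n} {suc t} (i ∷ I) (b ∷ a) = begin
  n                                        ≤⟨ free-fixing I a ⟩
  t + free (fixing I a)                    ≤⟨ +-monoʳ-≤ t (free-update (fixing I a) i b) ⟩
  t + suc (free (fixing (i ∷ I) (b ∷ a)))  ≡⟨ +-suc t _ ⟩
  suc t + free (fixing (i ∷ I) (b ∷ a))    ∎
  where open ≤-Reasoning

lookup-fixing : {I : Vec (Fin n) t} → Vec.Unique I → (a : Vec Bool t) (j : Fin t) →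
                lookup (fixing I a) (lookup I j) ≡ just (lookup a j)
lookup-fixing {I = i ∷ I} _           (b ∷ a) Fin.zero    = lookup∘update i (fixing I a) (just b)
lookup-fixing {I = i ∷ I} (i∉I ∷ uI)  (b ∷ a) (Fin.suc j) = begin
  lookup (fixing I a [ i ]≔ just b) (lookup I j) ≡⟨ lookup∘update′ (≢-sym (lookup⁺ i∉I j)) (fixing I a) (just b) ⟩
  lookup (fixing I a) (lookup I j)               ≡⟨ lookup-fixing uI a j ⟩
  just (lookup a j)                               ∎
  where open ≡-Reasoning

matched-entry : ∀ {p : Pattern n} {x} {i b} → Matches p x → lookup p i ≡ just b → b ≡ lookup x i
matched-entry {x = x} {i} m p[i]≡b = Maybe.drop-just (subst (Maybe.All (_≡ lookup x i)) p[i]≡b (Pointwise.lookup m i))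

matches⇒restrict≡ : ∀ {p : Pattern n} {x} (I : Vec (Fin n) t) (a : Vec Bool t) →
                    (∀ j → lookup p (lookup I j) ≡ just (lookup a j)) → Matches p x → restrict x I ≡ a
matches⇒restrict≡ []      []      _     _ = refl
matches⇒restrict≡ (i ∷ I) (b ∷ a) fixes m =
  cong₂ _∷_ (sym (matched-entry m (fixes Fin.zero))) (matches⇒restrict≡ I a (fixes ∘ Fin.suc) m)

StrictlyIncreasing⇒Unique : (I : Vec (Fin n) t) → StrictlyIncreasing I → Vec.Unique I
StrictlyIncreasing⇒Unique []      _   = []
StrictlyIncreasing⇒Unique (i ∷ I) inc =
  lookup⁻ (λ j → Finₚ.<⇒≢ (inc Fin.zero (Fin.suc j) z<s)) ∷
  StrictlyIncreasing⇒Unique I (λ j k j<k → inc (Fin.suc j) (Fin.suc k) (s<s j<k))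

complement-bound : ∀ m b c N → N ≤ m * c → b + c ≤ N → m * b ≤ N * (m ∸ 1)
complement-bound m b c N N≤m*c b+c≤N = begin
  m * b          ≤⟨ m+n≤o⇒m≤o∸n (m * b) m*b+N≤N*m ⟩
  N * m ∸ N      ≡⟨ cong (N * m ∸_) (sym (*-identityʳ N)) ⟩
  N * m ∸ N * 1  ≡⟨ sym (*-distribˡ-∸ N m 1) ⟩
  N * (m ∸ 1)    ∎
  where
  open ≤-Reasoning
  m*b+N≤N*m : m * b + N ≤ N * m
  m*b+N≤N*m = begin
    m * b + N      ≤⟨ +-monoʳ-≤ (m * b) N≤m*c ⟩
    m * b + m * c  ≡⟨ sym (*-distribˡ-+ m b c) ⟩
    m * (b + c)    ≤⟨ *-monoʳ-≤ m b+c≤N ⟩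
    m * N          ≡⟨ *-comm m N ⟩
    N * m          ∎

uncovered⇒bound : (A : List (Vec Bool n)) → Unique A →
                  (I : Vec (Fin n) t) → StrictlyIncreasing I → (a : Vec Bool t) → All (λ x → restrict x I ≢ a) A →
                  2 ^ t * length A ≤ 2 ^ n * (2 ^ t ∸ 1)
uncovered⇒bound {n} {t} A uA I inc a missed =
  complement-bound (2 ^ t) (length A) (2 ^ free p) (2 ^ n) cube≤ (avoiding⇒length+2^free≤2^n p A uA avoids)
  where
  p : Pattern n
  p = fixing I a
  avoids : All (¬_ ∘ Matches p) A
  avoids = All.map (λ x_I≢a → x_I≢a ∘ matches⇒restrict≡ I a (lookup-fixing (StrictlyIncreasing⇒Unique I inc) a)) missed
  cube≤ : 2 ^ n ≤ 2 ^ t * 2 ^ free p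
  cube≤ = ≤-trans (^-monoʳ-≤ 2 (free-fixing I a)) (≤-reflexive (^-distribˡ-+-* 2 t (free p)))

¬CoveringArray-elim : ∀ {Q : Set} {A : List (Vec Bool n)} → Dec Q →
                      ((I : Vec (Fin n) t) → StrictlyIncreasing I → (a : Vec Bool t) → All (λ x → restrict x I ≢ a) A → Q) →
                      ¬ CoveringArray t A → Q
¬CoveringArray-elim {t = t} {Q = Q} {A = A} Q? uncovered⇒Q ¬covering = decidable-stable Q? (¬covering ∘ covering)
  where
  covering : ¬ Q → CoveringArray t A
  covering ¬Q I inc a with any? (λ x → ≡-dec _≟ᵇ_ (restrict x I) a) A
  ... | yes hit  = find hit
  ... | no  miss = contradiction (uncovered⇒Q I inc a (¬Any⇒All¬ A miss)) ¬Q

proposition2p17 : (n k : ℕ) (A : List (Vec Bool n)) → Unique A →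
    CoveringArray k A → ¬ CoveringArray (suc k) A →
    2 ^ suc k * length A ≤ 2 ^ n * (2 ^ suc k ∸ 1)
proposition2p17 n k A unique _ ¬covering =
  ¬CoveringArray-elim (_ ≤? _) (uncovered⇒bound A unique) ¬covering
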